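{- Let $D_\lambda\in\mathfrak{D}_n$, let $g$ be a linear extension of $D_\lambda$, let $1\le k\le n$, and let $C$ be one of the chains of $D_\lambda$ with $g^{ -1}(i)\in C$. Then in $\partial_k(g)$, the chain $C$ contains the label $i$ if $i>k$, and contains the label $(i-1)\bmod k$ if $i\le k$; in particular it contains the label $k$ if $i=1$.
   Context: For a finite poset $X$ with $|X|=N$, a linear extension is a bijection $g:X\to\{1,\ldots,N\}$ with $g(a)<g(b)$ whenever $a<_X b$. For $1\le i\le N-1$ the Bender–Knuth involution $t_i$ swaps the labels $i$ and $i+1$ if $g^{ -1}(i)$, $g^{ -1}(i+1)$ are incomparable, and does nothing otherwise. Promotion: $\partial_1=\mathrm{id}$ and $\partial_k=t_{k-1}t_{k-2}\cdots t_1$ for $k\ge2$ (composition, $t_1$ applied first). $C_m$ is the $m$-element chain, $+$ is disjoint union; for $n>1$, $\mathfrak{D}_n$ is the set of posets $C_{\lambda_1}+\cdots+C_{\lambda_\ell}$ with $\lambda\vdash n$, $\ell>1$; $\mathfrak{D}_1=\{C_1\}$. Convention: $a\bmod k$ denotes the representative in $\{1,\ldots,k\}$. -}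

module Defs where

open import Data.Nat using (ℕ; zero; suc; _+_; _∸_; _≤_; _<_; _≤?_; _≟_)
open import Data.Nat.ListAction using (sum)
open import Data.Nat.DivMod using (_%_)
open import Data.Fin using (Fin; toℕ)
import Data.Fin.Properties as FinP
open import Data.List using (List; []; _∷_; length; lookup; map; concatMap; allFin)
open import Data.List.Relation.Unary.All using (All)
open import Data.List.Relation.Unary.Linked using (Linked)
open import Data.Maybe using (Maybe; just; nothing)
open import Data.Product using (Σ; Σ-syntax; ∃; _×_; _,_; proj₁; proj₂)
open import Data.Sum using (_⊎_)
open import Data.Bool using (Bool; true; false; if_then_else_)
open import Relation.Binary.PropositionalEquality using (_≡_)
open import Relation.Nullary using (Dec; yes; no; ¬_; does)
open import Relation.Nullary.Decidable using (_×-dec_; _⊎-dec_; ¬?)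
open import Function.Definitions using (Injective)

IsPartition : ℕ → List ℕ → Set
IsPartition n ps = All (λ p → 1 ≤ p) ps × Linked (λ a b → b ≤ a) ps × sum ps ≡ n

-- D_ps ∈ 𝔇_n :  n ≥ 1, ps ⊢ n, and (for n > 1) at least two parts.
-- (For n = 1 the only partition is (1), giving 𝔇_1 = {C_1}.)
InD : ℕ → List ℕ → Set
InD n ps = 1 ≤ n × IsPartition n ps × (1 < n → 1 < length ps)

-- an element: (index j of the chain, position p in the chain C_{ps_j})
Elem : List ℕ → Set
Elem ps = Σ[ j ∈ Fin (length ps) ] Fin (lookup ps j)

chain : (ps : List ℕ) → Elem ps → Fin (length ps)
chain ps = proj₁

LeP : (ps : List ℕ) → Elem ps → Elem ps → Set
LeP ps (j , p) (j' , q) = j ≡ j' × toℕ p ≤ toℕ q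

LtP : (ps : List ℕ) → Elem ps → Elem ps → Set
LtP ps (j , p) (j' , q) = j ≡ j' × toℕ p < toℕ q

LeP? : (ps : List ℕ) → (x y : Elem ps) → Dec (LeP ps x y)
LeP? ps (j , p) (j' , q) = (j FinP.≟ j') ×-dec (toℕ p ≤? toℕ q)

Comparable? : (ps : List ℕ) → (x y : Elem ps) → Dec (LeP ps x y ⊎ LeP ps y x)
Comparable? ps x y = LeP? ps x y ⊎-dec LeP? ps y x

allElems : (ps : List ℕ) → List (Elem ps)
allElems ps = concatMap (λ j → map (j ,_) (allFin (lookup ps j))) (allFin (length ps))

Labeling : List ℕ → Set
Labeling ps = Elem ps → ℕ

IsLinExt : (ps : List ℕ) → Labeling ps → Set
IsLinExt ps g =
  Injective _≡_ _≡_ g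
  × (∀ x → 1 ≤ g x × g x ≤ sum ps)
  × (∀ i → 1 ≤ i → i ≤ sum ps → ∃ λ x → g x ≡ i)
  × (∀ x y → LtP ps x y → g x < g y)

findLabel : (ps : List ℕ) → Labeling ps → ℕ → List (Elem ps) → Maybe (Elem ps)
findLabel ps g i [] = nothing
findLabel ps g i (x ∷ xs) = if does (g x ≟ i) then just x else findLabel ps g i xs

inv : (ps : List ℕ) → Labeling ps → ℕ → Maybe (Elem ps)
inv ps g i = findLabel ps g i (allElems ps)

swapVal : ℕ → ℕ → ℕ
swapVal i v = if does (v ≟ i) then suc i else (if does (v ≟ suc i) then i else v)

t : (ps : List ℕ) → ℕ → Labeling ps → Labeling ps
t ps i g x with inv ps g i | inv ps g (suc i)
... | just a | just b = if does (Comparable? ps a b) then g x else swapVal i (g x)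
... | _      | _      = g x

∂ : (ps : List ℕ) → ℕ → Labeling ps → Labeling ps
∂ ps zero g = g               -- unused junk value
∂ ps (suc zero) g = g
∂ ps (suc (suc m)) g = t ps (suc m) (∂ ps (suc m) g)

-- a mod k with representative in {1,…,k} (junk value for k = 0)
modR : ℕ → ℕ → ℕ
modR a zero = a
modR a (suc k) = if does (a % suc k ≟ 0) then suc k else a % suc k

ChainHasLabel : (ps : List ℕ) → Labeling ps → Fin (length ps) → ℕ → Set
ChainHasLabel ps h c v = Σ[ y ∈ Elem ps ] chain ps y ≡ c × h y ≡ v

{-# OPTIONS --safe #-}
-- By induction on k, h = ∂_k g keeps every label above k in place, the chain of
-- g⁻¹(1) carries the label k, and the chain of any x with 2 ≤ g(x) ≤ k carries
-- g(x) − 1. Applying t_k preserves this: if t_k swaps k and k+1, the label k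
-- becomes k+1 inside the chain of g⁻¹(1) and g⁻¹(k+1) receives k; if it does
-- not, then g⁻¹(k+1), still labelled k+1, is comparable to the element labelled
-- k, so both lie in the chain of g⁻¹(1).
module Submission where

open import Defs
open import Data.Nat using (ℕ; zero; suc; _≤_; _<_; _∸_; _≟_; z≤n; s≤s; s≤s⁻¹)
open import Data.Nat.Properties using (<-irrefl; <-trans; ≤-trans; ≤-refl; n<1+n; n≤1+n; m≤n⇒m<n∨m≡n; ∸-monoˡ-<)
open import Data.Nat.ListAction using (sum)
open import Data.Nat.DivMod using (m<n⇒m%n≡m)
open import Data.List using (List; _∷_)
open import Data.List.Membership.Propositional using (_∈_; lose)
open import Data.List.Membership.Propositional.Properties using (∈-concatMap⁺; ∈-allFin; ∈-map⁺)
open import Data.List.Relation.Unary.Any using (here; there)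
open import Data.Maybe using (just)
open import Data.Product using (_×_; _,_; proj₁; Σ)
open import Data.Sum using (_⊎_; inj₁; inj₂)
open import Data.Bool using (if_then_else_)
open import Data.Empty using (⊥-elim)
open import Relation.Binary.PropositionalEquality using (_≡_; refl; sym; trans; cong; subst)
open import Relation.Nullary using (Dec; yes; no; does; ¬_)
open import Relation.Nullary.Decidable using (dec-true; dec-false)
open import Function using (id)
open import Function.Definitions using (Injective)

swapVal-left : ∀ j → swapVal j j ≡ suc j
swapVal-left j rewrite dec-true (j ≟ j) refl = refl

swapVal-right : ∀ j → swapVal j (suc j) ≡ j
swapVal-right j rewrite dec-false (suc j ≟ j) (λ e → <-irrefl (sym e) (n<1+n j))
                      | dec-true (suc j ≟ suc j) refl = refl

swapVal-other : ∀ j v → ¬ v ≡ j → ¬ v ≡ suc j → swapVal j v ≡ v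
swapVal-other j v v≢j v≢1+j rewrite dec-false (v ≟ j) v≢j | dec-false (v ≟ suc j) v≢1+j = refl

swapVal-below : ∀ j v → v < j → swapVal j v ≡ v
swapVal-below j v v<j =
  swapVal-other j v (λ e → <-irrefl e v<j) (λ e → <-irrefl e (<-trans v<j (n<1+n j)))

swapVal-above : ∀ j v → suc j < v → swapVal j v ≡ v
swapVal-above j v 1+j<v =
  swapVal-other j v (λ e → <-irrefl (sym e) (<-trans (n<1+n j) 1+j<v)) (λ e → <-irrefl (sym e) 1+j<v)

swapVal-involutive : ∀ j v → swapVal j (swapVal j v) ≡ v
swapVal-involutive j v with v ≟ j
... | yes refl = trans (cong (swapVal j) (swapVal-left j)) (swapVal-right j)
... | no v≢j with v ≟ suc j
...   | yes refl = trans (cong (swapVal j) (swapVal-right j)) (swapVal-left j)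
...   | no v≢1+j = trans (cong (swapVal j) (swapVal-other j v v≢j v≢1+j)) (swapVal-other j v v≢j v≢1+j)

swapVal-injective : ∀ j → Injective _≡_ _≡_ (swapVal j)
swapVal-injective j {u} {v} e =
  trans (sym (swapVal-involutive j u)) (trans (cong (swapVal j) e) (swapVal-involutive j v))

∈-allElems : (ps : List ℕ) (y : Elem ps) → y ∈ allElems ps
∈-allElems ps (j , p) = ∈-concatMap⁺ _ (lose (∈-allFin j) (∈-map⁺ (j ,_) (∈-allFin p)))

findLabel-complete : (ps : List ℕ) (h : Labeling ps) {v : ℕ} {y : Elem ps} → h y ≡ v →
  (xs : List (Elem ps)) → y ∈ xs → Σ (Elem ps) λ a → findLabel ps h v xs ≡ just a × h a ≡ v
findLabel-complete ps h {v} hy≡v (x ∷ xs) y∈ with h x ≟ v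
... | yes hx≡v rewrite dec-true (h x ≟ v) hx≡v = x , refl , hx≡v
findLabel-complete ps h hy≡v (x ∷ xs) (here refl) | no hx≢v = ⊥-elim (hx≢v hy≡v)
findLabel-complete ps h hy≡v (x ∷ xs) (there y∈) | no hx≢v
  rewrite dec-false (h x ≟ _) hx≢v = findLabel-complete ps h hy≡v xs y∈

inv-complete : (ps : List ℕ) (h : Labeling ps) {v : ℕ} (y : Elem ps) → h y ≡ v →
  Σ (Elem ps) λ a → inv ps h v ≡ just a × h a ≡ v
inv-complete ps h y hy≡v = findLabel-complete ps h hy≡v (allElems ps) (∈-allElems ps y)

t-unfold : (ps : List ℕ) (j : ℕ) (h : Labeling ps) {a b : Elem ps} →
  inv ps h j ≡ just a → inv ps h (suc j) ≡ just b → (y : Elem ps) →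
  t ps j h y ≡ (if does (Comparable? ps a b) then h y else swapVal j (h y))
t-unfold ps j h ia ib y rewrite ia | ib = refl

comparable⇒same-chain : (ps : List ℕ) {a b : Elem ps} →
  LeP ps a b ⊎ LeP ps b a → chain ps a ≡ chain ps b
comparable⇒same-chain ps (inj₁ a≤b) = proj₁ a≤b
comparable⇒same-chain ps (inj₂ b≤a) = sym (proj₁ b≤a)

ChainHasLabel-map : (ps : List ℕ) {h h' : Labeling ps} (f : ℕ → ℕ) → (∀ y → h' y ≡ f (h y)) →
  ∀ {c v} → ChainHasLabel ps h c v → ChainHasLabel ps h' c (f v)
ChainHasLabel-map ps f h'≡fh (y , cy , hy) = y , cy , trans (h'≡fh y) (cong f hy)

record PromotionInvariant (ps : List ℕ) (g h : Labeling ps) (j : ℕ) : Set where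
  field
    injective     : Injective _≡_ _≡_ h
    fixed-above   : ∀ y → j < g y → h y ≡ g y
    chain-of-one  : ∀ x → g x ≡ 1 → ChainHasLabel ps h (chain ps x) j
    chain-shifted : ∀ x → 2 ≤ g x → g x ≤ j → ChainHasLabel ps h (chain ps x) (g x ∸ 1)

invariant-base : (ps : List ℕ) (g : Labeling ps) → IsLinExt ps g → PromotionInvariant ps g g 1
invariant-base ps g (g-injective , _) = record
  { injective     = g-injective
  ; fixed-above   = λ _ _ → refl
  ; chain-of-one  = λ x gx≡1 → x , refl , gx≡1
  ; chain-shifted = λ x 2≤gx gx≤1 → ⊥-elim (<-irrefl refl (≤-trans 2≤gx gx≤1))
  }

module _ {ps : List ℕ} {g h : Labeling ps} {j : ℕ} (I : PromotionInvariant ps g h j) where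
  open PromotionInvariant I

  label-next : ∀ x → g x ≡ suc j → h x ≡ suc j
  label-next x gx≡1+j = trans (fixed-above x (subst (j <_) (sym gx≡1+j) (n<1+n j))) gx≡1+j

  fixed-above-next : ∀ y → suc j < g y → j < g y
  fixed-above-next y 1+j<gy = <-trans (n<1+n j) 1+j<gy

  invariant-unswapped : {h' : Labeling ps} (a b : Elem ps) → h a ≡ j → h b ≡ suc j →
    chain ps a ≡ chain ps b → (∀ y → h' y ≡ h y) → PromotionInvariant ps g h' (suc j)
  invariant-unswapped {h'} a b ha hb a~b h'≡h = record
    { injective     = λ {u} {v} e → injective (trans (sym (h'≡h u)) (trans e (h'≡h v)))
    ; fixed-above   = λ y 1+j<gy → trans (h'≡h y) (fixed-above y (fixed-above-next y 1+j<gy))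
    ; chain-of-one  = λ x gx≡1 → b , trans (sym a~b) (a-in-chain-of-one x gx≡1) , trans (h'≡h b) hb
    ; chain-shifted = shifted
    }
    where
    a-in-chain-of-one : ∀ x → g x ≡ 1 → chain ps a ≡ chain ps x
    a-in-chain-of-one x gx≡1 with chain-of-one x gx≡1
    ... | y , cy , hy≡j = trans (cong (chain ps) (injective (trans ha (sym hy≡j)))) cy

    shifted : ∀ x → 2 ≤ g x → g x ≤ suc j → ChainHasLabel ps h' (chain ps x) (g x ∸ 1)
    shifted x 2≤gx gx≤1+j with m≤n⇒m<n∨m≡n gx≤1+j
    ... | inj₁ gx<1+j = ChainHasLabel-map ps id h'≡h (chain-shifted x 2≤gx (s≤s⁻¹ gx<1+j))
    ... | inj₂ gx≡1+j =
      a , trans a~b (cong (chain ps) (injective (trans hb (sym (label-next x gx≡1+j)))))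
        , trans (h'≡h a) (trans ha (cong (_∸ 1) (sym gx≡1+j)))

  invariant-swapped : {h' : Labeling ps} → (∀ y → h' y ≡ swapVal j (h y)) →
    PromotionInvariant ps g h' (suc j)
  invariant-swapped {h'} h'≡sh = record
    { injective     = λ {u} {v} e →
        injective (swapVal-injective j (trans (sym (h'≡sh u)) (trans e (h'≡sh v))))
    ; fixed-above   = λ y 1+j<gy → trans (h'≡sh y)
        (trans (cong (swapVal j) (fixed-above y (fixed-above-next y 1+j<gy))) (swapVal-above j (g y) 1+j<gy))
    ; chain-of-one  = λ x gx≡1 →
        subst (ChainHasLabel ps h' (chain ps x)) (swapVal-left j)
          (ChainHasLabel-map ps (swapVal j) h'≡sh (chain-of-one x gx≡1))
    ; chain-shifted = shifted
    }
    where
    shifted : ∀ x → 2 ≤ g x → g x ≤ suc j → ChainHasLabel ps h' (chain ps x) (g x ∸ 1)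
    shifted x 2≤gx gx≤1+j with m≤n⇒m<n∨m≡n gx≤1+j
    ... | inj₁ gx<1+j =
      subst (ChainHasLabel ps h' (chain ps x)) (swapVal-below j (g x ∸ 1) gx∸1<j)
        (ChainHasLabel-map ps (swapVal j) h'≡sh (chain-shifted x 2≤gx (s≤s⁻¹ gx<1+j)))
      where
      gx∸1<j : g x ∸ 1 < j
      gx∸1<j = ∸-monoˡ-< gx<1+j (≤-trans (s≤s z≤n) 2≤gx)
    ... | inj₂ gx≡1+j =
      x , refl , trans (h'≡sh x) (trans (cong (swapVal j) (label-next x gx≡1+j))
                   (trans (swapVal-right j) (cong (_∸ 1) (sym gx≡1+j))))

  invariant-t : {h' : Labeling ps} (a b : Elem ps) → h a ≡ j → h b ≡ suc j →
    (d : Dec (LeP ps a b ⊎ LeP ps b a)) →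
    (∀ y → h' y ≡ (if does d then h y else swapVal j (h y))) → PromotionInvariant ps g h' (suc j)
  invariant-t a b ha hb (yes a~b) = invariant-unswapped a b ha hb (comparable⇒same-chain ps a~b)
  invariant-t a b ha hb (no _)    = invariant-swapped

invariant-step : (ps : List ℕ) (g : Labeling ps) → IsLinExt ps g → (j : ℕ) → suc j ≤ sum ps →
  (h : Labeling ps) → PromotionInvariant ps g h j → PromotionInvariant ps g (t ps j h) (suc j)
invariant-step ps g (_ , _ , g-surjective , _) j 1+j≤N h I
  with g-surjective 1 ≤-refl (≤-trans (s≤s z≤n) 1+j≤N) | g-surjective (suc j) (s≤s z≤n) 1+j≤N
... | x₁ , gx₁≡1 | xₙ , gxₙ≡1+j
  with PromotionInvariant.chain-of-one I x₁ gx₁≡1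
... | y , _ , hy≡j
  with inv-complete ps h y hy≡j | inv-complete ps h xₙ (label-next I xₙ gxₙ≡1+j)
... | a , ia , ha | b , ib , hb =
  invariant-t I a b ha hb (Comparable? ps a b) (t-unfold ps j h ia ib)

promotion-invariant : (ps : List ℕ) (g : Labeling ps) → IsLinExt ps g →
  ∀ m → suc m ≤ sum ps → PromotionInvariant ps g (∂ ps (suc m) g) (suc m)
promotion-invariant ps g lin zero _ = invariant-base ps g lin
promotion-invariant ps g lin (suc m) 2+m≤N =
  invariant-step ps g lin (suc m) 2+m≤N (∂ ps (suc m) g)
    (promotion-invariant ps g lin m (≤-trans (n≤1+n _) 2+m≤N))

modR-small : ∀ a m → 1 ≤ a → a < suc m → modR a (suc m) ≡ a
modR-small (suc a) m _ a<1+m rewrite m<n⇒m%n≡m {suc m} {suc a} a<1+m = refl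

lemma3p1 : (n : ℕ) (ps : List ℕ) → InD n ps →
    (g : Labeling ps) → IsLinExt ps g →
    (k : ℕ) → 1 ≤ k → k ≤ n →
    (i : ℕ) (x : Elem ps) → g x ≡ i →
    (k < i → ChainHasLabel ps (∂ ps k g) (chain ps x) i)
    × (i ≤ k → ChainHasLabel ps (∂ ps k g) (chain ps x) (modR (i ∸ 1) k))
    × (i ≡ 1 → ChainHasLabel ps (∂ ps k g) (chain ps x) k)
lemma3p1 n ps (_ , (_ , _ , sum≡n) , _) g lin@(_ , g-range , _) (suc m) _ k≤n i x gx≡i =
  above , below gx≡i (subst (1 ≤_) gx≡i (proj₁ (g-range x)))
        , (λ i≡1 → chain-of-one x (trans gx≡i i≡1))
  where
  open PromotionInvariant (promotion-invariant ps g lin m (subst (suc m ≤_) (sym sum≡n) k≤n))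

  above : suc m < i → ChainHasLabel ps (∂ ps (suc m) g) (chain ps x) i
  above k<i = x , refl , trans (fixed-above x (subst (suc m <_) (sym gx≡i) k<i)) gx≡i

  below : ∀ {v} → g x ≡ v → 1 ≤ v → v ≤ suc m →
    ChainHasLabel ps (∂ ps (suc m) g) (chain ps x) (modR (v ∸ 1) (suc m))
  below {suc zero}     gx≡1 _ _ = chain-of-one x gx≡1
  below {suc (suc v')} gx≡v _ v≤k =
    subst (ChainHasLabel ps _ (chain ps x))
      (trans (cong (_∸ 1) gx≡v) (sym (modR-small (suc v') m (s≤s z≤n) v≤k)))
      (chain-shifted x (subst (2 ≤_) (sym gx≡v) (s≤s (s≤s z≤n))) (subst (_≤ suc m) (sym gx≡v) v≤k))
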